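{- Let $k \geq 1$ and let $G$ be a TRVG with $n$ vertices whose vertex set is partitioned into $k$ nonempty independent sets. Then $G$ has at most $2(k-1)n - k(k-1)$ edges.
   Context: A (finite, simple) graph $G$ is a transparent rectangle visibility graph (TRVG) if there is an assignment of a rectangle $R_v$ in the plane to each vertex $v$, where each $R_v$ is a nondegenerate closed rectangle with sides parallel to the coordinate axes and distinct rectangles have disjoint interiors, such that for all distinct vertices $u,v$: $u$ and $v$ are adjacent if and only if there is a horizontal line or a vertical line meeting the interiors of both $R_u$ and $R_v$.
   Formalization: The rectangles $R_v$ have rational corners, and the horizontal and vertical lines and the points tested for disjoint interiors lie at rational positions, rather than anywhere in the plane. -}

module Defs where

open import Level using (0ℓ)
open import Data.Nat using (ℕ)
open import Data.Fin using (Fin; _<_; _<?_)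
open import Data.Fin.Properties using ()
open import Data.List using (List; length; filter; allFin; cartesianProduct)
open import Data.Product using (Σ; _×_; _,_; ∃; ∃-syntax)
open import Data.Sum using (_⊎_)
open import Data.Rational using (ℚ) renaming (_<_ to _<ℚ_)
open import Relation.Nullary using (¬_)
open import Relation.Nullary.Decidable using (_×-dec_)
open import Relation.Binary using (Decidable)
open import Relation.Binary.PropositionalEquality using (_≡_; _≢_)
open import Function.Bundles using (_⇔_)
open import Function.Definitions using (Surjective)

record Graph (n : ℕ) : Set₁ where
  field
    Adj     : Fin n → Fin n → Set
    adj?    : Decidable Adj
    sym     : ∀ {u v} → Adj u v → Adj v u
    irrefl  : ∀ {u} → ¬ Adj u u

open Graph public

edgeCount : ∀ {n} → Graph n → ℕ
edgeCount {n} G =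
  length (filter (λ p → (Σ.proj₁ p <? Σ.proj₂ p) ×-dec adj? G (Σ.proj₁ p) (Σ.proj₂ p))
                 (cartesianProduct (allFin n) (allFin n)))

record Rect : Set where
  field
    x₁ x₂ y₁ y₂ : ℚ
    x₁<x₂ : x₁ <ℚ x₂
    y₁<y₂ : y₁ <ℚ y₂

open Rect public

_∈⦅_,_⦆ : ℚ → ℚ → ℚ → Set
c ∈⦅ a , b ⦆ = (a <ℚ c) × (c <ℚ b)

InInterior : ℚ → ℚ → Rect → Set
InInterior p q R = (p ∈⦅ x₁ R , x₂ R ⦆) × (q ∈⦅ y₁ R , y₂ R ⦆)

InteriorsDisjoint : Rect → Rect → Set
InteriorsDisjoint R S = ¬ (∃[ p ] ∃[ q ] (InInterior p q R × InInterior p q S))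

HorizontalSight : Rect → Rect → Set
HorizontalSight R S = ∃[ c ] ((c ∈⦅ y₁ R , y₂ R ⦆) × (c ∈⦅ y₁ S , y₂ S ⦆))

VerticalSight : Rect → Rect → Set
VerticalSight R S = ∃[ c ] ((c ∈⦅ x₁ R , x₂ R ⦆) × (c ∈⦅ x₁ S , x₂ S ⦆))

record TRVGRep {n : ℕ} (G : Graph n) : Set₁ where
  field
    rect     : Fin n → Rect
    disjoint : ∀ {u v} → u ≢ v → InteriorsDisjoint (rect u) (rect v)
    adj⇔     : ∀ {u v} → u ≢ v →
               Adj G u v ⇔ (HorizontalSight (rect u) (rect v) ⊎ VerticalSight (rect u) (rect v))

IsTRVG : ∀ {n} → Graph n → Set₁
IsTRVG G = TRVGRep G

record IndepPartition {n : ℕ} (G : Graph n) (k : ℕ) : Set where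
  field
    part        : Fin n → Fin k
    nonempty    : Surjective _≡_ _≡_ part
    independent : ∀ {u v} → Adj G u v → part u ≢ part v

-- Every edge of a TRVG is a horizontal or a vertical visibility, i.e. an overlap of the
-- y- or of the x-projections of the two rectangles, so the edges are covered by two
-- interval overlap graphs, each properly coloured by the k independent classes. In such a
-- graph the interval with the rightmost left endpoint and the intervals it meets all
-- contain the points just right of that endpoint, so they form a clique and it has at most
-- k-1 neighbours. Removing it and repeating shows that each overlap graph is
-- (k-1)-degenerate, hence has at most Σ_{i<n} min(i, k-1) = (k-1)n - k(k-1)/2 edges,
-- as n ≥ k.

module Submission where

open import Defs
open import Data.Nat using (ℕ; _+_; _*_; _∸_; _≤_)

open import Level using (0ℓ)
open import Function using (_∘_; id)
open import Function.Bundles using (Equivalence)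
open import Function.Definitions using (Surjective)
open import Data.Nat using (zero; suc; z≤n; s≤s; _<_; _≥_; _⊓_)
open import Data.Nat.Properties
  using (≤-refl; ≤-trans; n≤1+n; +-mono-≤; +-monoˡ-≤; +-monoʳ-≤; +-suc; ∸-monoˡ-≤;
         ⊓-glb; m≤n⇒m⊓n≡m; m≥n⇒m⊓n≡n; m≤n+m; m∸n+n≡m; suc-injective; +-comm;
         +-commutativeSemigroup;
         module ≤-Reasoning)
open import Algebra.Properties.CommutativeSemigroup +-commutativeSemigroup using (interchange; x∙yz≈y∙xz)
open import Data.Nat.Tactic.RingSolver using (solve; solve-∀)
open import Data.Fin as Fin using (Fin)
open import Data.Fin.Properties using (injective⇒≤; <-asym)
open import Data.Rational as ℚ using (ℚ)
import Data.Rational.Properties as ℚₚ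
open import Data.Product using (_×_; _,_; proj₁; proj₂; ∃-syntax; ∃₂)
open import Data.Sum using (inj₁; inj₂)
import Data.Sum as Sum
open import Data.List using (List; []; _∷_; [_]; length; filter; map; allFin; cartesianProduct; lookup)
open import Data.List.Properties
  using (filter-++; length-++; filter-accept; filter-reject; length-filter; length-tabulate)
open import Data.List.Membership.Propositional.Properties using (∈-lookup)
open import Data.List.Relation.Unary.All as All using (All; []; _∷_)
open import Data.List.Relation.Unary.All.Properties using (all-filter) renaming (filter⁺ to All-filter⁺)
open import Data.List.Relation.Unary.AllPairs as AllPairs using (AllPairs; []; _∷_)
open import Data.List.Relation.Unary.AllPairs.Properties using (tabulate⁺-<)
open import Data.List.Relation.Unary.Unique.Propositional using (Unique)
open import Data.List.Relation.Unary.Unique.Propositional.Properties using (allFin⁺)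
  renaming (filter⁺ to Unique-filter⁺)
open import Data.List.Relation.Binary.Permutation.Propositional as ↭ using (_↭_; ↭⇒↭ₛ)
open import Data.List.Relation.Binary.Permutation.Propositional.Properties using (↭-length; filter-↭)
import Data.List.Relation.Binary.Permutation.Setoid.Properties as ↭ₛ
open import Relation.Nullary using (yes; no; contradiction)
open import Relation.Nullary.Decidable using (_×-dec_)
open import Relation.Unary as U using (Pred; _⊆_; _∪_)
open import Relation.Binary using (Rel; Decidable; Symmetric; Asymmetric)
open import Relation.Binary.PropositionalEquality
  using (_≡_; _≢_; refl; trans; cong; cong₂; subst; setoid; module ≡-Reasoning)
  renaming (sym to ≡-sym)

pairCount : ∀ {A : Set} {R : Rel A 0ℓ} → Decidable R → List A → ℕ
pairCount R? []       = 0
pairCount R? (x ∷ xs) = length (filter (R? x) xs) + pairCount R? xs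

length-filter-∷ : ∀ {A : Set} {P : Pred A 0ℓ} (P? : U.Decidable P) x xs →
                  length (filter P? xs) ≤ length (filter P? (x ∷ xs))
length-filter-∷ P? x xs with P? x
... | yes _ = n≤1+n _
... | no  _ = ≤-refl

module _ {A : Set} {Q Q′ : Pred A 0ℓ} (Q? : U.Decidable Q) (Q′? : U.Decidable Q′) where

  length-filter-∷-∪ : ∀ {x} xs → (Q ∪ Q′) x →
                      suc (length (filter Q? xs) + length (filter Q′? xs)) ≤
                      length (filter Q? (x ∷ xs)) + length (filter Q′? (x ∷ xs))
  length-filter-∷-∪ {x} xs (inj₁ q) rewrite filter-accept Q? {xs = xs} q =
    s≤s (+-monoʳ-≤ _ (length-filter-∷ Q′? x xs))
  length-filter-∷-∪ {x} xs (inj₂ q′)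
    rewrite filter-accept Q′? {xs = xs} q′ | +-suc (length (filter Q? (x ∷ xs))) (length (filter Q′? xs)) =
    s≤s (+-monoˡ-≤ _ (length-filter-∷ Q? x xs))

  length-filter-⊆∪ : ∀ {P : Pred A 0ℓ} (P? : U.Decidable P) → P ⊆ Q ∪ Q′ → ∀ xs →
                     length (filter P? xs) ≤ length (filter Q? xs) + length (filter Q′? xs)
  length-filter-⊆∪ P? P⊆Q∪Q′ []       = z≤n
  length-filter-⊆∪ P? P⊆Q∪Q′ (x ∷ xs) with P? x
  ... | no _  = ≤-trans (length-filter-⊆∪ P? P⊆Q∪Q′ xs)
                        (+-mono-≤ (length-filter-∷ Q? x xs) (length-filter-∷ Q′? x xs))
  ... | yes p = ≤-trans (s≤s (length-filter-⊆∪ P? P⊆Q∪Q′ xs)) (length-filter-∷-∪ xs (P⊆Q∪Q′ p))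

module _ {A : Set} {R S T : Rel A 0ℓ} (R? : Decidable R) (S? : Decidable S) (T? : Decidable T) where

  pairCount-⊆∪ : (∀ x → R x ⊆ S x ∪ T x) → ∀ xs →
                 pairCount R? xs ≤ pairCount S? xs + pairCount T? xs
  pairCount-⊆∪ R⊆S∪T []       = z≤n
  pairCount-⊆∪ R⊆S∪T (x ∷ xs) = begin
    length (filter (R? x) xs) + pairCount R? xs
      ≤⟨ +-mono-≤ (length-filter-⊆∪ (S? x) (T? x) (R? x) (R⊆S∪T x) xs) (pairCount-⊆∪ R⊆S∪T xs) ⟩
    (length (filter (S? x) xs) + length (filter (T? x) xs)) + (pairCount S? xs + pairCount T? xs)
      ≡⟨ interchange (length (filter (S? x) xs)) (length (filter (T? x) xs))
                     (pairCount S? xs) (pairCount T? xs) ⟩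
    (length (filter (S? x) xs) + pairCount S? xs) + (length (filter (T? x) xs) + pairCount T? xs) ∎
    where open ≤-Reasoning

module _ {A : Set} {_≺_ R : Rel A 0ℓ}
         (_≺?_ : Decidable _≺_) (≺-asym : Asymmetric _≺_) (R? : Decidable R) where

  Increasing? : U.Decidable (λ (p : A × A) → proj₁ p ≺ proj₂ p × R (proj₁ p) (proj₂ p))
  Increasing? p = (proj₁ p ≺? proj₂ p) ×-dec R? (proj₁ p) (proj₂ p)

  increasingPairs : List A → List A → ℕ
  increasingPairs xs ys = length (filter Increasing? (cartesianProduct xs ys))

  increasingPairs-∷ˡ : ∀ x xs ys →
    increasingPairs (x ∷ xs) ys ≡ length (filter Increasing? (map (x ,_) ys)) + increasingPairs xs ys
  increasingPairs-∷ˡ x xs ys =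
    trans (cong length (filter-++ Increasing? (map (x ,_) ys) (cartesianProduct xs ys)))
          (length-++ (filter Increasing? (map (x ,_) ys)))

  increasing-fromMinimum : ∀ {x ys} → All (x ≺_) ys →
                           length (filter Increasing? (map (x ,_) ys)) ≡ length (filter (R? x) ys)
  increasing-fromMinimum []                     = refl
  increasing-fromMinimum {x} {y ∷ ys} (x≺y ∷ x≺ys) with x ≺? y | R? x y
  ... | no x⊀y | _     = contradiction x≺y x⊀y
  ... | yes _  | yes _ = cong suc (increasing-fromMinimum x≺ys)
  ... | yes _  | no _  = increasing-fromMinimum x≺ys

  increasing-toMinimum : ∀ {x xs} ys → All (x ≺_) xs → increasingPairs xs (x ∷ ys) ≡ increasingPairs xs ys
  increasing-toMinimum ys [] = refl
  increasing-toMinimum {x} {z ∷ xs} ys (x≺z ∷ x≺xs) = begin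
    increasingPairs (z ∷ xs) (x ∷ ys)
      ≡⟨ increasingPairs-∷ˡ z xs (x ∷ ys) ⟩
    length (filter Increasing? ((z , x) ∷ map (z ,_) ys)) + increasingPairs xs (x ∷ ys)
      ≡⟨ cong₂ _+_ (cong length (filter-reject Increasing? (≺-asym x≺z ∘ proj₁)))
                   (increasing-toMinimum ys x≺xs) ⟩
    length (filter Increasing? (map (z ,_) ys)) + increasingPairs xs ys
      ≡⟨ increasingPairs-∷ˡ z xs ys ⟨
    increasingPairs (z ∷ xs) ys ∎
    where open ≡-Reasoning

  increasingPairs-sorted : ∀ {xs} → AllPairs _≺_ xs → increasingPairs xs xs ≡ pairCount R? xs
  increasingPairs-sorted []                         = refl
  increasingPairs-sorted {x ∷ xs} (x≺xs ∷ sorted) = begin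
    increasingPairs (x ∷ xs) (x ∷ xs)
      ≡⟨ increasingPairs-∷ˡ x xs (x ∷ xs) ⟩
    length (filter Increasing? ((x , x) ∷ map (x ,_) xs)) + increasingPairs xs (x ∷ xs)
      ≡⟨ cong₂ _+_ (cong length (filter-reject Increasing? (λ (x≺x , _) → ≺-asym x≺x x≺x)))
                   (increasing-toMinimum xs x≺xs) ⟩
    length (filter Increasing? (map (x ,_) xs)) + increasingPairs xs xs
      ≡⟨ cong₂ _+_ (increasing-fromMinimum x≺xs) (increasingPairs-sorted sorted) ⟩
    pairCount R? (x ∷ xs) ∎
    where open ≡-Reasoning

edgeCount≡pairCount : ∀ {n} (G : Graph n) → edgeCount G ≡ pairCount (adj? G) (allFin n)
edgeCount≡pairCount G = increasingPairs-sorted Fin._<?_ <-asym (adj? G) (tabulate⁺-< id)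

module _ {A : Set} {R : Rel A 0ℓ} (R? : Decidable R) (R-sym : Symmetric R) where

  pairCount-swap : ∀ x y xs → pairCount R? (x ∷ y ∷ xs) ≡ pairCount R? (y ∷ x ∷ xs)
  pairCount-swap x y xs with R? x y | R? y x
  ... | yes _   | yes _   = cong suc (x∙yz≈y∙xz (length (filter (R? x) xs)) (length (filter (R? y) xs)) _)
  ... | no  _   | no  _   = x∙yz≈y∙xz (length (filter (R? x) xs)) (length (filter (R? y) xs)) _
  ... | yes xRy | no ¬yRx = contradiction (R-sym xRy) ¬yRx
  ... | no ¬xRy | yes yRx = contradiction (R-sym yRx) ¬xRy

  pairCount-resp-↭ : ∀ {xs ys} → xs ↭ ys → pairCount R? xs ≡ pairCount R? ys
  pairCount-resp-↭ ↭.refl         = refl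
  pairCount-resp-↭ (↭.prep x p)   = cong₂ _+_ (↭-length (filter-↭ (R? x) p)) (pairCount-resp-↭ p)
  pairCount-resp-↭ (↭.swap x y p) =
    trans (pairCount-swap x y _)
          (cong₂ _+_ (↭-length (filter-↭ (R? y) (↭.prep x p)))
                     (cong₂ _+_ (↭-length (filter-↭ (R? x) p)) (pairCount-resp-↭ p)))
  pairCount-resp-↭ (↭.trans p q)  = trans (pairCount-resp-↭ p) (pairCount-resp-↭ q)

Unique-resp-↭ : ∀ {A : Set} {xs ys : List A} → xs ↭ ys → Unique xs → Unique ys
Unique-resp-↭ {A} p = ↭ₛ.Unique-resp-↭ (setoid A) (↭⇒↭ₛ p)

degenerateEdgeBound : ℕ → ℕ → ℕ
degenerateEdgeBound d zero    = 0
degenerateEdgeBound d (suc N) = degenerateEdgeBound d N + N ⊓ d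

module _ {A : Set} {R : Rel A 0ℓ} (R? : Decidable R) where

  Degenerate : ℕ → Set
  Degenerate d = ∀ {x xs} → Unique (x ∷ xs) →
                 ∃₂ λ m ys → (x ∷ xs ↭ m ∷ ys) × length (filter (R? m) ys) ≤ d

  pairCount≤degenerateEdgeBound : Symmetric R → ∀ {d} → Degenerate d →
                                  ∀ {xs} → Unique xs → pairCount R? xs ≤ degenerateEdgeBound d (length xs)
  pairCount≤degenerateEdgeBound R-sym {d} degenerate = bound refl
    where
      bound : ∀ {N xs} → length xs ≡ N → Unique xs → pairCount R? xs ≤ degenerateEdgeBound d N
      bound {zero}  {[]}     _   _    = z≤n
      bound {suc N} {x ∷ xs} len uniq with degenerate uniq
      ... | m , ys , x∷xs↭m∷ys , few = begin
        pairCount R? (x ∷ xs)                       ≡⟨ pairCount-resp-↭ R? R-sym x∷xs↭m∷ys ⟩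
        length (filter (R? m) ys) + pairCount R? ys ≤⟨ +-mono-≤ (⊓-glb neighbours≤N few) (bound len-ys uniq-ys) ⟩
        N ⊓ d + degenerateEdgeBound d N             ≡⟨ +-comm (N ⊓ d) _ ⟩
        degenerateEdgeBound d (suc N)               ∎
        where
          open ≤-Reasoning
          len-ys : length ys ≡ N
          len-ys = suc-injective (trans (≡-sym (↭-length x∷xs↭m∷ys)) len)
          uniq-ys : Unique ys
          uniq-ys = AllPairs.tail (Unique-resp-↭ x∷xs↭m∷ys uniq)
          neighbours≤N : length (filter (R? m) ys) ≤ N
          neighbours≤N = subst (_ ≤_) len-ys (length-filter (R? m) ys)

pairCount-allFin≤ : ∀ {n} {R : Rel (Fin n) 0ℓ} (R? : Decidable R) → Symmetric R →
                    ∀ {d} → Degenerate R? d →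
                    pairCount R? (allFin n) ≤ degenerateEdgeBound d n
pairCount-allFin≤ {n} R? R-sym {d} degenerate =
  subst (λ N → pairCount R? (allFin n) ≤ degenerateEdgeBound d N) (length-tabulate {n = n} id)
        (pairCount≤degenerateEdgeBound R? R-sym degenerate (allFin⁺ n))

degenerateEdgeBound-triangular : ∀ {d} i → i ≤ d →
  degenerateEdgeBound d (suc i) + degenerateEdgeBound d (suc i) ≡ suc i * i
degenerateEdgeBound-triangular zero    _     = refl
degenerateEdgeBound-triangular {d} (suc i) 1+i≤d rewrite m≤n⇒m⊓n≡m 1+i≤d = begin
  (B + suc i) + (B + suc i) ≡⟨ interchange B (suc i) B (suc i) ⟩
  (B + B) + (suc i + suc i) ≡⟨ cong (_+ (suc i + suc i)) (degenerateEdgeBound-triangular i i≤d) ⟩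
  suc i * i + (suc i + suc i) ≡⟨ solve [ i ] ⟩
  suc (suc i) * suc i       ∎
  where
    open ≡-Reasoning
    B : ℕ
    B = degenerateEdgeBound d (suc i)
    i≤d : i ≤ d
    i≤d = ≤-trans (n≤1+n i) 1+i≤d

degenerateEdgeBound-beyond : ∀ d m →
  degenerateEdgeBound d (m + suc d) + degenerateEdgeBound d (m + suc d) + suc d * d ≡ 2 * d * (m + suc d)
degenerateEdgeBound-beyond d zero = begin
  B + B + suc d * d     ≡⟨ cong (_+ suc d * d) (degenerateEdgeBound-triangular d ≤-refl) ⟩
  suc d * d + suc d * d ≡⟨ solve [ d ] ⟩
  2 * d * suc d         ∎
  where
    open ≡-Reasoning
    B : ℕ
    B = degenerateEdgeBound d (suc d)
degenerateEdgeBound-beyond d (suc m)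
  rewrite m≥n⇒m⊓n≡n (≤-trans (n≤1+n d) (m≤n+m (suc d) m)) = begin
  (B + d) + (B + d) + suc d * d   ≡⟨ regroup B d ⟩
  (B + B + suc d * d) + 2 * d     ≡⟨ cong (_+ 2 * d) (degenerateEdgeBound-beyond d m) ⟩
  2 * d * (m + suc d) + 2 * d     ≡⟨ distrib d m ⟩
  2 * d * suc (m + suc d)         ∎
  where
    open ≡-Reasoning
    B : ℕ
    B = degenerateEdgeBound d (m + suc d)
    regroup : ∀ x y → (x + y) + (x + y) + suc y * y ≡ (x + x + suc y * y) + 2 * y
    regroup = solve-∀
    distrib : ∀ x y → 2 * x * (y + suc x) + 2 * x ≡ 2 * x * suc (y + suc x)
    distrib = solve-∀

degenerateEdgeBound-closedForm : ∀ {d n} → d < n →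
  degenerateEdgeBound d n + degenerateEdgeBound d n + suc d * d ≡ 2 * d * n
degenerateEdgeBound-closedForm {d} {n} d<n =
  subst (λ N → degenerateEdgeBound d N + degenerateEdgeBound d N + suc d * d ≡ 2 * d * N)
        (m∸n+n≡m d<n) (degenerateEdgeBound-beyond d (n ∸ suc d))

extractMax : ∀ {A : Set} (key : A → ℚ) x xs →
             ∃₂ λ m ys → (x ∷ xs ↭ m ∷ ys) × All (λ y → key y ℚ.≤ key m) ys
extractMax key x []       = x , [] , ↭.refl , []
extractMax key x (y ∷ xs) with extractMax key y xs
... | m , ys , y∷xs↭m∷ys , ys≤m with ℚₚ.≤-total (key m) (key x)
...   | inj₁ m≤x = x , m ∷ ys , ↭.prep x y∷xs↭m∷ys , m≤x ∷ All.map (λ y≤m → ℚₚ.≤-trans y≤m m≤x) ys≤m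
...   | inj₂ x≤m = m , x ∷ ys , ↭.trans (↭.prep x y∷xs↭m∷ys) (↭.swap x m ↭.refl) , x≤m ∷ ys≤m

All⇒AllPairs : ∀ {A : Set} {P : Pred A 0ℓ} {R : Rel A 0ℓ} → (∀ {x y} → P x → P y → R x y) →
               ∀ {xs} → All P xs → AllPairs R xs
All⇒AllPairs P⇒R []         = []
All⇒AllPairs P⇒R (px ∷ pxs) = All.map (P⇒R px) pxs ∷ All⇒AllPairs P⇒R pxs

pairwiseDistinctImages⇒length≤ : ∀ {A : Set} {k} (f : A → Fin k) {xs} →
                                 AllPairs (λ x y → f x ≢ f y) xs → length xs ≤ k
pairwiseDistinctImages⇒length≤ f distinct = injective⇒≤ (lookup-injective distinct)
  where
    lookup-injective : ∀ {xs} → AllPairs (λ x y → f x ≢ f y) xs →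
                       ∀ {i j} → f (lookup xs i) ≡ f (lookup xs j) → i ≡ j
    lookup-injective (_ ∷ _)        {Fin.zero}  {Fin.zero}  _  = refl
    lookup-injective (fx≢ ∷ _)      {Fin.zero}  {Fin.suc j} eq = contradiction eq (All.lookup fx≢ (∈-lookup j))
    lookup-injective (fx≢ ∷ _)      {Fin.suc i} {Fin.zero}  eq =
      contradiction (≡-sym eq) (All.lookup fx≢ (∈-lookup i))
    lookup-injective (_ ∷ distinct) {Fin.suc i} {Fin.suc j} eq = cong Fin.suc (lookup-injective distinct eq)

below-both : ∀ {l b b′} → l ℚ.< b → l ℚ.< b′ → ∃[ c ] (l ℚ.< c × c ℚ.< b × c ℚ.< b′)
below-both l<b l<b′ with ℚₚ.≤-total _ _
... | inj₁ b≤b′ = let c , l<c , c<b = ℚₚ.<-dense l<b in c , l<c , c<b , ℚₚ.<-≤-trans c<b b≤b′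
... | inj₂ b′≤b = let c , l<c , c<b′ = ℚₚ.<-dense l<b′ in c , l<c , ℚₚ.<-≤-trans c<b′ b′≤b , c<b′

module Intervals {I : Set} (a b : I → ℚ) (a<b : ∀ v → a v ℚ.< b v) where

  Overlap : Rel I 0ℓ
  Overlap u v = a u ℚ.< b v × a v ℚ.< b u

  overlap? : Decidable Overlap
  overlap? u v = (a u ℚ.<? b v) ×-dec (a v ℚ.<? b u)

  overlap-sym : Symmetric Overlap
  overlap-sym (p , q) = q , p

  sharedPoint⇒overlap : ∀ {u v c} → c ∈⦅ a u , b u ⦆ × c ∈⦅ a v , b v ⦆ → Overlap u v
  sharedPoint⇒overlap ((au<c , c<bu) , (av<c , c<bv)) = ℚₚ.<-trans au<c c<bv , ℚₚ.<-trans av<c c<bu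

  overlap⇒sharedPoint : ∀ {u v} → Overlap u v → ∃[ c ] (c ∈⦅ a u , b u ⦆ × c ∈⦅ a v , b v ⦆)
  overlap⇒sharedPoint {u} {v} (au<bv , av<bu) with ℚₚ.≤-total (a u) (a v)
  ... | inj₁ au≤av = let c , av<c , c<bu , c<bv = below-both av<bu (a<b v) in
                     c , (ℚₚ.≤-<-trans au≤av av<c , c<bu) , (av<c , c<bv)
  ... | inj₂ av≤au = let c , au<c , c<bu , c<bv = below-both (a<b u) au<bv in
                     c , (au<c , c<bu) , (ℚₚ.≤-<-trans av≤au au<c , c<bv)

  overlapping-rightmost : ∀ {m ys} → All (λ y → a y ℚ.≤ a m) ys →
                          AllPairs Overlap (filter (overlap? m) (m ∷ ys))
  overlapping-rightmost {m} {ys} ys≤m =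
    All⇒AllPairs (λ (u≤m , mu) (w≤m , mw) → ℚₚ.≤-<-trans u≤m (proj₁ mw) , ℚₚ.≤-<-trans w≤m (proj₁ mu))
                 (All.zip (All-filter⁺ (overlap? m) (ℚₚ.≤-refl ∷ ys≤m) , all-filter (overlap? m) (m ∷ ys)))

  overlap-degenerate : ∀ {k} (colour : I → Fin k) →
                       (∀ {u v} → u ≢ v → Overlap u v → colour u ≢ colour v) →
                       Degenerate overlap? (k ∸ 1)
  overlap-degenerate {k} colour proper {x} {xs} uniq with extractMax a x xs
  ... | m , ys , x∷xs↭m∷ys , ys≤m = m , ys , x∷xs↭m∷ys , ∸-monoˡ-≤ 1 clique≤k
    where
      clique : List I
      clique = filter (overlap? m) (m ∷ ys)
      clique-colours : AllPairs (λ u w → colour u ≢ colour w) clique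
      clique-colours = AllPairs.zipWith (λ (u≢w , uw) → proper u≢w uw)
        (Unique-filter⁺ (overlap? m) (Unique-resp-↭ x∷xs↭m∷ys uniq) , overlapping-rightmost ys≤m)
      clique≤k : suc (length (filter (overlap? m) ys)) ≤ k
      clique≤k = subst (_≤ _) (cong length (filter-accept (overlap? m) (a<b m , a<b m)))
                       (pairwiseDistinctImages⇒length≤ colour clique-colours)

surjective⇒≥ : ∀ {m n} (f : Fin m → Fin n) → Surjective _≡_ _≡_ f → m ≥ n
surjective⇒≥ {m} {n} f surjective = injective⇒≤ section-injective
  where
    section : Fin n → Fin m
    section y = proj₁ (surjective y)
    section-injective : ∀ {y y′} → section y ≡ section y′ → y ≡ y′
    section-injective {y} {y′} eq =
      trans (≡-sym (proj₂ (surjective y) refl)) (trans (cong f eq) (proj₂ (surjective y′) refl))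

module Visibility {n} {G : Graph n} (rep : TRVGRep G) {k} (colouring : IndepPartition G k) where
  open TRVGRep rep
  open IndepPartition colouring

  module Rows    = Intervals (λ v → y₁ (rect v)) (λ v → y₂ (rect v)) (λ v → y₁<y₂ (rect v))
  module Columns = Intervals (λ v → x₁ (rect v)) (λ v → x₂ (rect v)) (λ v → x₁<x₂ (rect v))

  edge⇒overlap : ∀ u → Adj G u ⊆ Rows.Overlap u ∪ Columns.Overlap u
  edge⇒overlap u {v} uv =
    Sum.map (Rows.sharedPoint⇒overlap ∘ proj₂) (Columns.sharedPoint⇒overlap ∘ proj₂)
            (Equivalence.to (adj⇔ u≢v) uv)
    where
      u≢v : u ≢ v
      u≢v refl = irrefl G uv

  rows-degenerate : Degenerate Rows.overlap? (k ∸ 1)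
  rows-degenerate = Rows.overlap-degenerate part λ u≢v →
    independent ∘ Equivalence.from (adj⇔ u≢v) ∘ inj₁ ∘ Rows.overlap⇒sharedPoint

  columns-degenerate : Degenerate Columns.overlap? (k ∸ 1)
  columns-degenerate = Columns.overlap-degenerate part λ u≢v →
    independent ∘ Equivalence.from (adj⇔ u≢v) ∘ inj₂ ∘ Columns.overlap⇒sharedPoint

theorem4 : (n k : ℕ) → 1 ≤ k → (G : Graph n) → IsTRVG G → IndepPartition G k →
    edgeCount G + k * (k ∸ 1) ≤ 2 * (k ∸ 1) * n
theorem4 n (suc d) _ G rep colouring = begin
  edgeCount G + suc d * d
    ≡⟨ cong (_+ suc d * d) (edgeCount≡pairCount G) ⟩
  pairCount (adj? G) (allFin n) + suc d * d
    ≤⟨ +-monoˡ-≤ _ (pairCount-⊆∪ (adj? G) Rows.overlap? Columns.overlap? edge⇒overlap (allFin n)) ⟩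
  pairCount Rows.overlap? (allFin n) + pairCount Columns.overlap? (allFin n) + suc d * d
    ≤⟨ +-monoˡ-≤ _ (+-mono-≤ (pairCount-allFin≤ Rows.overlap? Rows.overlap-sym rows-degenerate)
                             (pairCount-allFin≤ Columns.overlap? Columns.overlap-sym columns-degenerate)) ⟩
  degenerateEdgeBound d n + degenerateEdgeBound d n + suc d * d
    ≡⟨ degenerateEdgeBound-closedForm (surjective⇒≥ part nonempty) ⟩
  2 * d * n ∎
  where
    open ≤-Reasoning
    open Visibility rep colouring
    open IndepPartition colouring using (part; nonempty)
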